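{- Let $G$ be an $\alpha$-weakly-Helly graph and $H=\mathcal{H}(G)$ its injective hull. For any $M\subseteq V(G)$, $rad_G(M)-\alpha\le rad_H(M)\le rad_G(M)$. In particular, $rad(G)-\alpha\le rad(H)\le rad(G)$.
   Context: All graphs are finite, simple, undirected, unweighted and connected. $D_G(v,r)=\{u: d_G(u,v)\le r\}$. A graph $G$ is $\alpha$-weakly-Helly if for every family of pairwise intersecting disks $\{D_G(v,r(v)) : v\in S\}$ the disks $D_G(v,r(v)+\alpha)$, $v\in S$, have a common vertex; Helly graphs are the $0$-weakly-Helly graphs. The injective hull $\mathcal{H}(G)$ is the unique minimal Helly graph containing $G$ as an isometric subgraph; $V(G)$ is identified with its image. For $X\in\{G,H\}$: $e_X^M(v)=\max_{u\in M}d_X(v,u)$, $rad_X(M)=\min_{v\in V(X)}e_X^M(v)$, $rad(X)=rad_X(V(X))$ (for $X=H$, $rad(H)$ is the minimum eccentricity in $H$). -}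

module Defs where

open import Data.Nat using (ℕ; zero; suc; _+_; _≤_; _⊔_; _⊓_)
open import Data.Bool using (Bool; true; false; _∨_; _∧_; if_then_else_)
open import Data.Fin using (Fin)
open import Data.Fin.Properties using (_≟_)
open import Data.Fin.Subset using (Subset; _∈_; ⊤)
open import Data.List using (List; []; _∷_; map; foldr; allFin)
open import Data.Bool.ListAction using (any)
open import Data.Vec using (lookup)
open import Data.Product using (∃; _×_)
open import Relation.Nullary.Decidable using (isYes)
open import Relation.Binary.PropositionalEquality using (_≡_)

reach : {n : ℕ} → (Fin n → Fin n → Bool) → ℕ → Fin n → Fin n → Bool
reach adj zero    u v = isYes (u ≟ v)
reach adj (suc k) u v =
  reach adj k u v ∨ any (λ w → reach adj k u w ∧ adj w v) (allFin _)

-- least k in [start, start + fuel) with p k = true (or start + fuel)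
search : (ℕ → Bool) → ℕ → ℕ → ℕ
search p k zero     = k
search p k (suc f)  = if p k then k else search p (suc k) f

record Graph : Set where
  field
    n         : ℕ
    adj       : Fin n → Fin n → Bool
    adj-sym   : ∀ u v → adj u v ≡ adj v u
    irrefl    : ∀ u → adj u u ≡ false
    connected : ∀ u v → ∃ λ k → reach adj k u v ≡ true

open Graph public

-- shortest-path distance d_X(u,v): least k such that u, v are joined by
-- a walk of length ≤ k (k ≤ n suffices in a connected graph).
dist : (X : Graph) → Fin (n X) → Fin (n X) → ℕ
dist X u v = search (λ k → reach (adj X) k u v) 0 (suc (n X))

WeaklyHelly : ℕ → Graph → Set
WeaklyHelly α X =
  (S : Subset (n X)) (r : Fin (n X) → ℕ) →
  (∀ x y → x ∈ S → y ∈ S → ∃ λ u → dist X u x ≤ r x × dist X u y ≤ r y) →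
  ∃ λ u → ∀ x → x ∈ S → dist X u x ≤ r x + α

Helly : Graph → Set
Helly X = WeaklyHelly 0 X

-- isometric embeddings (identify G with its image in H)

Isometric : (G H : Graph) → (Fin (n G) → Fin (n H)) → Set
Isometric G H φ = ∀ u v → dist H (φ u) (φ v) ≡ dist G u v

-- H (with isometric embedding φ of G) is the injective hull of G:
-- H is Helly, contains G isometrically, and is minimal: any Helly graph H'
-- lying isometrically between G and H (compatibly with φ) is all of H.
InjectiveHull : (G H : Graph) → (Fin (n G) → Fin (n H)) → Set
InjectiveHull G H φ =
  Helly H × Isometric G H φ ×
  ((H' : Graph) (φ' : Fin (n G) → Fin (n H')) (ψ : Fin (n H') → Fin (n H)) →
    Helly H' → Isometric G H' φ' → Isometric H' H ψ →
    (∀ u → ψ (φ' u) ≡ φ u) →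
    ∀ w → ∃ λ x → ψ x ≡ w)

maxL : List ℕ → ℕ
maxL = foldr _⊔_ 0

minL : List ℕ → ℕ
minL []       = 0
minL (x ∷ xs) = foldr _⊓_ x xs

-- e_X^M(v) = max_{u ∈ M} d_X(v, f u), where M ⊆ Fin k and f : Fin k → V(X)
ecc : (X : Graph) {k : ℕ} → (Fin k → Fin (n X)) → Subset k → Fin (n X) → ℕ
ecc X {k} f M v =
  maxL (map (λ u → if lookup M u then dist X v (f u) else 0) (allFin k))

rad : (X : Graph) {k : ℕ} → (Fin k → Fin (n X)) → Subset k → ℕ
rad X f M = minL (map (ecc X f M) (allFin (n X)))

radius : Graph → ℕ
radius X = rad X (λ v → v) ⊤

-- Radii are minima of eccentricities, so each inequality is an instance of one
-- comparison principle for minima (minL-compare): match every vertex of one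
-- graph with a vertex of the other of no larger eccentricity (up to α).
--   * rad_H(M) ≤ rad_G(M): vertices of G keep their eccentricity in H (isometry).
--   * rad_G(M) ≤ rad_H(M) + α: for c ∈ V(H) and e = e^M_H(c) the disks D_G(x, e),
--     x ∈ M, meet pairwise, so weak Helliness gives u with e^M_G(u) ≤ e + α.
--   * rad(H) ≤ rad(G): a disk of H containing G induces an isometric Helly
--     subgraph (BallSubgraph), hence is all of H by minimality of the hull.
--   * rad(G) − α ≤ rad(H): the case M = V(G) and rad_H(V(G)) ≤ rad(H).
module Submission where

open import Defs
open import Data.Nat using (ℕ; zero; suc; _+_; _≤_; _<_; _∸_; _⊓_; z≤n; s≤s; _≤?_)
open import Data.Nat.Properties hiding (_≟_)
open import Data.Bool using (Bool; true; false; T; if_then_else_)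
open import Data.Bool.Properties using (T-∨; T-∧; T-≡)
open import Data.Fin using (Fin; zero; suc)
open import Data.Fin.Properties using (_≟_)
open import Data.Fin.Subset using (Subset; _∈_; _⊆_; ⊤; ∣_∣)
open import Data.Fin.Subset.Properties
  using (_∈?_; _⊂?_; ∈⊤; ∣p∣≤n; ∣⁅x⁆∣≡1; x∈⁅y⁆⇒x≡y; p⊆q⇒∣p∣≤∣q∣; p⊂q⇒∣p∣<∣q∣)
open import Data.List using (List; []; _∷_; map; foldr; allFin; filter; length)
open import Data.List.Properties using (map-cong)
import Data.List as List
open import Data.List.Membership.Propositional using (lose) renaming (_∈_ to _∈ₗ_)
open import Data.List.Membership.Propositional.Properties
  using (∈-allFin; ∈-map⁺; ∈-map⁻; ∈-filter⁺; ∈-filter⁻; ∈-lookup; foldr-selective)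
import Data.List.Relation.Unary.All as All
open import Data.List.Relation.Unary.AllPairs using (_∷_)
open import Data.List.Relation.Unary.Unique.Propositional using (Unique)
open import Data.List.Relation.Unary.Unique.Propositional.Properties using (filter⁺; allFin⁺)
open import Data.List.Relation.Unary.Any using (here; there; satisfied; index)
open import Data.List.Relation.Unary.Any.Properties using (any⁺; any⁻; lookup-index)
open import Data.Vec using (tabulate; lookup)
open import Data.Vec.Properties using (lookup∘tabulate; []=⇒lookup; lookup⇒[]=)
open import Data.Product using (∃; _×_; _,_; proj₁; proj₂)
open import Data.Sum using (_⊎_; inj₁; inj₂)
open import Data.Empty using (⊥; ⊥-elim)
open import Function using (Equivalence)
open import Relation.Nullary using (yes; no; contradiction)
open import Relation.Nullary.Decidable using (toWitness; fromWitness)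
open import Relation.Binary.PropositionalEquality
  using (_≡_; refl; sym; trans; cong; cong₂; subst; module ≡-Reasoning)

module Walks {N : ℕ} (adj : Fin N → Fin N → Bool) where

  -- Reach k u v : u and v are joined by a walk of length at most k
  -- (a record, so that k, u and v can be inferred from a proof).
  record Reach (k : ℕ) (u v : Fin N) : Set where
    constructor walk
    field holds : T (reach adj k u v)

  reach-zero⁻ : ∀ {u v} → Reach 0 u v → u ≡ v
  reach-zero⁻ (walk r) = toWitness r

  reach-zero⁺ : ∀ u → Reach 0 u u
  reach-zero⁺ u = walk (fromWitness refl)

  reach-suc⁻ : ∀ {k u v} → Reach (suc k) u v →
               Reach k u v ⊎ ∃ λ w → Reach k u w × T (adj w v)
  reach-suc⁻ (walk r) with Equivalence.to T-∨ r
  ... | inj₁ short = inj₁ (walk short)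
  ... | inj₂ long with satisfied (any⁻ _ (allFin _) long)
  ...   | w , rw with Equivalence.to T-∧ rw
  ...     | r′ , e = inj₂ (w , walk r′ , e)

  reach-suc⁺ : ∀ {k u v} → Reach k u v → Reach (suc k) u v
  reach-suc⁺ (walk r) = walk (Equivalence.from T-∨ (inj₁ r))

  reach-extend : ∀ {k u w v} → Reach k u w → T (adj w v) → Reach (suc k) u v
  reach-extend {w = w} (walk r) e = walk (Equivalence.from T-∨
    (inj₂ (any⁺ _ (lose (∈-allFin w) (Equivalence.from T-∧ (r , e))))))

  reach-mono : ∀ {k k′ u v} → k ≤ k′ → Reach k u v → Reach k′ u v
  reach-mono {k} {k′} {u} {v} le r = subst (λ j → Reach j u v) (m∸n+n≡m le) (pad (k′ ∸ k))
    where
      pad : ∀ j → Reach (j + k) u v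
      pad zero    = r
      pad (suc j) = reach-suc⁺ (pad j)

  reach-trans : ∀ a b {u v w} → Reach a u v → Reach b v w → Reach (a + b) u w
  reach-trans a zero r s rewrite reach-zero⁻ s | +-identityʳ a = r
  reach-trans a (suc b) r s rewrite +-suc a b with reach-suc⁻ s
  ... | inj₁ s′           = reach-suc⁺ (reach-trans a b r s′)
  ... | inj₂ (x , s′ , e) = reach-extend (reach-trans a b r s′) e

  reach-edge : ∀ {u v} → T (adj u v) → Reach 1 u v
  reach-edge {u} = reach-extend (reach-zero⁺ u)

  reach-sym : (∀ u v → adj u v ≡ adj v u) → ∀ k {u v} → Reach k u v → Reach k v u
  reach-sym sym-adj zero r rewrite reach-zero⁻ r = reach-zero⁺ _
  reach-sym sym-adj (suc k) {v = v} r with reach-suc⁻ r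
  ... | inj₁ r′ = reach-suc⁺ (reach-sym sym-adj k r′)
  ... | inj₂ (w , r′ , e) =
    reach-trans 1 k (reach-edge (subst T (sym-adj w v) e)) (reach-sym sym-adj k r′)

  -- The sets reached k u of vertices within k steps from u grow with k; as
  -- they live in a set of size N, they stabilise after at most N steps.
  reached : ℕ → Fin N → Subset N
  reached k u = tabulate (reach adj k u)

  ∈-reached⁺ : ∀ {k u v} → Reach k u v → v ∈ reached k u
  ∈-reached⁺ {k} {u} {v} (walk r) =
    lookup⇒[]= v (reached k u) (trans (lookup∘tabulate _ v) (Equivalence.to T-≡ r))

  ∈-reached⁻ : ∀ {k u v} → v ∈ reached k u → Reach k u v
  ∈-reached⁻ {k} {u} {v} m =
    walk (Equivalence.from T-≡ (trans (sym (lookup∘tabulate _ v)) ([]=⇒lookup m)))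

  reached-grows : ∀ {k u} → reached k u ⊆ reached (suc k) u
  reached-grows {k} {u} m = ∈-reached⁺ (reach-suc⁺ (∈-reached⁻ {k} {u} m))

  Stable : ℕ → Fin N → Set
  Stable k u = reached (suc k) u ⊆ reached k u

  stable-forever : ∀ {k u} → Stable k u → ∀ j {v} → Reach (j + k) u v → Reach k u v
  stable-forever st zero    r = r
  stable-forever st (suc j) r with reach-suc⁻ r
  ... | inj₁ r′           = stable-forever st j r′
  ... | inj₂ (w , r′ , e) =
    ∈-reached⁻ (st (∈-reached⁺ (reach-extend (stable-forever st j r′) e)))

  stabilises-or-grows : ∀ u k → (∃ λ j → j ≤ k × Stable j u) ⊎ suc k ≤ ∣ reached k u ∣
  stabilises-or-grows u zero = inj₂ (subst (_≤ ∣ reached 0 u ∣) (∣⁅x⁆∣≡1 u)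
    (p⊆q⇒∣p∣≤∣q∣ λ m →
      ∈-reached⁺ (subst (Reach 0 u) (sym (x∈⁅y⁆⇒x≡y u m)) (reach-zero⁺ u))))
  stabilises-or-grows u (suc k) with stabilises-or-grows u k
  ... | inj₁ (j , j≤k , st) = inj₁ (j , m≤n⇒m≤1+n j≤k , st)
  ... | inj₂ grown with reached k u ⊂? reached (suc k) u
  ...   | yes grows = inj₂ (≤-trans (s≤s grown) (p⊂q⇒∣p∣<∣q∣ grows))
  ...   | no ¬grows = inj₁ (k , n≤1+n k , stuck)
    where
      stuck : Stable k u
      stuck {v} m with v ∈? reached k u
      ... | yes old = old
      ... | no new  = contradiction
        ((λ {_} → reached-grows {k} {u}) , v , m , new) ¬grows

  reach-within-N : ∀ k {u v} → Reach k u v → Reach N u v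
  reach-within-N k {u} r with stabilises-or-grows u N
  ... | inj₂ tooMany = contradiction (∣p∣≤n (reached N u)) (<⇒≱ tooMany)
  ... | inj₁ (j , j≤N , st) =
    reach-mono j≤N (stable-forever st k (reach-mono (m≤m+n k j) r))

reach-map : ∀ {N M} (adj : Fin N → Fin N → Bool) (adj′ : Fin M → Fin M → Bool)
            (ψ : Fin N → Fin M) → (∀ {u v} → T (adj u v) → T (adj′ (ψ u) (ψ v))) →
            ∀ k {u v} → Walks.Reach adj k u v → Walks.Reach adj′ k (ψ u) (ψ v)
reach-map adj adj′ ψ hom zero r rewrite Walks.reach-zero⁻ adj r = Walks.reach-zero⁺ adj′ _
reach-map adj adj′ ψ hom (suc k) r with Walks.reach-suc⁻ adj r
... | inj₁ r′           = Walks.reach-suc⁺ adj′ (reach-map adj adj′ ψ hom k r′)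
... | inj₂ (w , r′ , e) = Walks.reach-extend adj′ (reach-map adj adj′ ψ hom k r′) (hom e)

search-le : ∀ (p : ℕ → Bool) s f {k} → T (p k) → s ≤ k → search p s f ≤ k
search-le p s zero    pk s≤k = s≤k
search-le p s (suc f) pk s≤k with p s in eq
... | true  = s≤k
... | false = search-le p (suc s) f pk (≤∧≢⇒< s≤k λ { refl → subst T eq pk })

search-found : ∀ (p : ℕ → Bool) s f {k} → T (p k) → s ≤ k → k < s + f →
               T (p (search p s f))
search-found p s zero    pk s≤k k<s rewrite +-identityʳ s = contradiction s≤k (<⇒≱ k<s)
search-found p s (suc f) {k} pk s≤k k<s with p s in eq
... | true  = subst T (sym eq) _
... | false = search-found p (suc s) f pk (≤∧≢⇒< s≤k λ { refl → subst T eq pk })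
                (subst (k <_) (+-suc s f) k<s)

module Distance (X : Graph) where
  open Walks (adj X) public

  reach-N : ∀ u v → Reach (n X) u v
  reach-N u v = reach-within-N (proj₁ (connected X u v))
                               (walk (Equivalence.from T-≡ (proj₂ (connected X u v))))

  dist-reach : ∀ u v → Reach (dist X u v) u v
  dist-reach u v = walk (search-found (λ k → reach (adj X) k u v) 0 (suc (n X))
                           (Reach.holds (reach-N u v)) z≤n ≤-refl)

  dist-least : ∀ {k u v} → Reach k u v → dist X u v ≤ k
  dist-least {u = u} {v} (walk r) = search-le (λ k → reach (adj X) k u v) 0 (suc (n X)) r z≤n

  dist⇒reach : ∀ {k u v} → dist X u v ≤ k → Reach k u v
  dist⇒reach {u = u} {v} le = reach-mono le (dist-reach u v)

  dist-unique : ∀ {u v t} → (∀ k → Reach k u v → t ≤ k) → Reach t u v → dist X u v ≡ t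
  dist-unique {u} {v} least r = ≤-antisym (dist-least r) (least _ (dist-reach u v))

  dist-bounded : ∀ u v → dist X u v ≤ n X
  dist-bounded u v = dist-least (reach-N u v)

  dist-refl : ∀ u → dist X u u ≡ 0
  dist-refl u = n≤0⇒n≡0 (dist-least (reach-zero⁺ u))

  dist≤0 : ∀ {u v} → dist X u v ≤ 0 → u ≡ v
  dist≤0 le = reach-zero⁻ (dist⇒reach le)

  dist-sym : ∀ u v → dist X u v ≡ dist X v u
  dist-sym u v = ≤-antisym (one-way u v) (one-way v u)
    where
      one-way : ∀ u v → dist X u v ≤ dist X v u
      one-way u v = dist-least (reach-sym (adj-sym X) _ (dist-reach v u))

  dist-triangle : ∀ u v w → dist X u w ≤ dist X u v + dist X v w
  dist-triangle u v w = dist-least (reach-trans _ _ (dist-reach u v) (dist-reach v w))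

  dist-edge : ∀ {u v} → T (adj X u v) → dist X u v ≤ 1
  dist-edge e = dist-least (reach-edge e)

  dist≤1 : ∀ {u v} → dist X u v ≤ 1 → u ≡ v ⊎ T (adj X u v)
  dist≤1 le with reach-suc⁻ (dist⇒reach le)
  ... | inj₁ r           = inj₁ (reach-zero⁻ r)
  ... | inj₂ (w , r , e) rewrite reach-zero⁻ r = inj₂ e

  dist-step : ∀ {k x y} → dist X x y ≤ suc k →
              dist X x y ≤ k ⊎ ∃ λ w → dist X x w ≤ k × T (adj X w y)
  dist-step le with reach-suc⁻ (dist⇒reach le)
  ... | inj₁ r           = inj₁ (dist-least r)
  ... | inj₂ (w , r , e) = inj₂ (w , dist-least r , e)

  dist-split : ∀ a b {x y} → dist X x y ≤ a + b → ∃ λ u → dist X x u ≤ a × dist X u y ≤ b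
  dist-split a b {x} {y} le with reach-split b (dist⇒reach le)
    where
      reach-split : ∀ b {y} → Reach (a + b) x y → ∃ λ u → Reach a x u × Reach b u y
      reach-split zero    r rewrite +-identityʳ a = _ , r , reach-zero⁺ _
      reach-split (suc b) r rewrite +-suc a b with reach-suc⁻ r
      ... | inj₁ r′ with reach-split b r′
      ...   | u , p , q = u , p , reach-suc⁺ q
      reach-split (suc b) r | inj₂ (w , r′ , e) with reach-split b r′
      ...   | u , p , q = u , p , reach-extend q e
  ... | u , p , q = u , dist-least p , dist-least q

foldr-⊓-≤-init : ∀ z xs → foldr _⊓_ z xs ≤ z
foldr-⊓-≤-init z []       = ≤-refl
foldr-⊓-≤-init z (y ∷ xs) = ≤-trans (m⊓n≤n y _) (foldr-⊓-≤-init z xs)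

foldr-⊓-≤ : ∀ z {x xs} → x ∈ₗ xs → foldr _⊓_ z xs ≤ x
foldr-⊓-≤ z (here refl)        = m⊓n≤m _ _
foldr-⊓-≤ z (there {x = y} m) = ≤-trans (m⊓n≤n y _) (foldr-⊓-≤ z m)

minL-≤ : ∀ {k} (e : Fin k → ℕ) i → minL (map e (allFin k)) ≤ e i
minL-≤ {suc k} e i with ∈-map⁺ e (∈-allFin i)
... | here eq   = subst (minL (map e (allFin (suc k))) ≤_) (sym eq)
                        (foldr-⊓-≤-init (e zero) (map e (List.tabulate suc)))
... | there mem = foldr-⊓-≤ (e zero) mem

minL-bounded : ∀ {k b} (e : Fin k → ℕ) → (∀ i → e i ≤ b) → minL (map e (allFin k)) ≤ b
minL-bounded {zero}  e bound = z≤n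
minL-bounded {suc k} e bound = ≤-trans (minL-≤ e zero) (bound zero)

minL-attained : ∀ {k} (e : Fin k → ℕ) →
                (Fin k → ⊥) ⊎ ∃ λ i → e i ≡ minL (map e (allFin k))
minL-attained {zero}  e = inj₁ λ ()
minL-attained {suc k} e with foldr-selective ⊓-sel (e zero) (map e (List.tabulate suc))
... | inj₁ eq  = inj₂ (zero , sym eq)
... | inj₂ mem with ∈-map⁻ e mem
...   | i , _ , eq = inj₂ (i , sym eq)

minL-compare : ∀ {a b} (e : Fin a → ℕ) (e′ : Fin b → ℕ) α →
               (∀ j → ∃ λ i → e i ≤ e′ j + α) → ((Fin b → ⊥) → ∀ i → e i ≤ α) →
               minL (map e (allFin a)) ≤ minL (map e′ (allFin b)) + α
minL-compare e e′ α match empty with minL-attained e′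
... | inj₁ none = ≤-trans (minL-bounded e (empty none)) (m≤n+m α _)
... | inj₂ (j , eq) with match j
...   | i , le = ≤-trans (minL-≤ e i) (≤-trans le (≤-reflexive (cong (_+ α) eq)))

maxL-lub : ∀ {A : Set} {b} (h : A → ℕ) xs → (∀ x → h x ≤ b) → maxL (map h xs) ≤ b
maxL-lub h []       bound = z≤n
maxL-lub h (x ∷ xs) bound = ⊔-lub (bound x) (maxL-lub h xs bound)

≤-maxL : ∀ {A : Set} (h : A → ℕ) {x xs} → x ∈ₗ xs → h x ≤ maxL (map h xs)
≤-maxL h (here refl)          = m≤m⊔n _ _
≤-maxL h (there {x = y} mem) = m≤n⇒m≤o⊔n (h y) (≤-maxL h mem)

module _ (X : Graph) {k : ℕ} (f : Fin k → Fin (n X)) (M : Subset k) where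

  ecc-term : Fin (n X) → Fin k → ℕ
  ecc-term v u = if lookup M u then dist X v (f u) else 0

  ecc-lub : ∀ {v b} → (∀ {u} → u ∈ M → dist X v (f u) ≤ b) → ecc X f M v ≤ b
  ecc-lub {v} {b} bound = maxL-lub (ecc-term v) (allFin k) term≤b
    where
      term≤b : ∀ u → ecc-term v u ≤ b
      term≤b u with lookup M u in eq
      ... | true  = bound (lookup⇒[]= u M eq)
      ... | false = z≤n

  dist≤ecc : ∀ {v u} → u ∈ M → dist X v (f u) ≤ ecc X f M v
  dist≤ecc {v} {u} u∈M = subst (_≤ ecc X f M v) term-in (≤-maxL (ecc-term v) (∈-allFin u))
    where
      term-in : ecc-term v u ≡ dist X v (f u)
      term-in rewrite []=⇒lookup u∈M = refl

Disk : Graph → Set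
Disk X = Fin (n X) × ℕ

InDisk : (X : Graph) → Fin (n X) → Disk X → Set
InDisk X u (c , r) = dist X u c ≤ r

Meet : (X : Graph) → Disk X → Disk X → Set
Meet X D E = ∃ λ u → InDisk X u D × InDisk X u E

-- The Helly property, stated for one disk per centre, extends to arbitrary
-- finite families of disks: for each centre keep only the smallest disk (or,
-- if there is none, the disk of radius n X, which is the whole graph).
helly-family : (X : Graph) → Helly X → (Ds : List (Disk X)) →
               (∀ {D E} → D ∈ₗ Ds → E ∈ₗ Ds → Meet X D E) →
               ∃ λ u → ∀ {D} → D ∈ₗ Ds → InDisk X u D
helly-family X hX Ds pairwise = conclude (hX ⊤ least-radius pairwise′)
  where
    open Distance X

    centred : Fin (n X) → List (Disk X)
    centred v = filter (λ D → proj₁ D ≟ v) Ds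

    least-radius : Fin (n X) → ℕ
    least-radius v = foldr _⊓_ (n X) (map proj₂ (centred v))

    least-radius≤ : ∀ {c r} → (c , r) ∈ₗ Ds → least-radius c ≤ r
    least-radius≤ {c} mem =
      foldr-⊓-≤ (n X) (∈-map⁺ proj₂ (∈-filter⁺ (λ D → proj₁ D ≟ c) mem refl))

    least-radius-choice : ∀ v →
      least-radius v ≡ n X ⊎ ∃ λ r → (v , r) ∈ₗ Ds × least-radius v ≡ r
    least-radius-choice v with foldr-selective ⊓-sel (n X) (map proj₂ (centred v))
    ... | inj₁ eq  = inj₁ eq
    ... | inj₂ mem with ∈-map⁻ proj₂ mem
    ...   | (c , r) , mem′ , eq with ∈-filter⁻ (λ D → proj₁ D ≟ v) {xs = Ds} mem′
    ...     | mem″ , refl = inj₂ (r , mem″ , eq)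

    pairwise′ : ∀ x y → x ∈ ⊤ → y ∈ ⊤ →
                ∃ λ u → dist X u x ≤ least-radius x × dist X u y ≤ least-radius y
    pairwise′ x y _ _ with least-radius-choice x | least-radius-choice y
    ... | inj₁ eq | _ = y , subst (dist X y x ≤_) (sym eq) (dist-bounded y x)
                          , subst (_≤ least-radius y) (sym (dist-refl y)) z≤n
    ... | inj₂ _ | inj₁ eq = x , subst (_≤ least-radius x) (sym (dist-refl x)) z≤n
                               , subst (dist X x y ≤_) (sym eq) (dist-bounded x y)
    ... | inj₂ (r , mx , eqx) | inj₂ (r′ , my , eqy) with pairwise mx my
    ...   | u , ux , uy = u , subst (dist X u x ≤_) (sym eqx) ux , subst (dist X u y ≤_) (sym eqy) uy

    conclude : (∃ λ u → ∀ x → x ∈ ⊤ → dist X u x ≤ least-radius x + 0) →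
               ∃ λ u → ∀ {D} → D ∈ₗ Ds → InDisk X u D
    conclude (u , common) = u , λ { {c , r} mem →
      ≤-trans (common c ∈⊤) (≤-trans (≤-reflexive (+-identityʳ _)) (least-radius≤ mem)) }

StepClosed : (X : Graph) {m : ℕ} → (Fin m → Fin (n X)) → Set
StepClosed X ψ = ∀ i j k → dist X (ψ i) (ψ j) ≤ suc k →
  dist X (ψ i) (ψ j) ≤ k ⊎ ∃ λ l → dist X (ψ i) (ψ l) ≤ k × T (adj X (ψ l) (ψ j))

module Induced (X : Graph) {m : ℕ} (ψ : Fin m → Fin (n X))
               (ψ-injective : ∀ {i j} → ψ i ≡ ψ j → i ≡ j) (closed : StepClosed X ψ) where
  open Distance X

  adjᵢ : Fin m → Fin m → Bool
  adjᵢ i j = adj X (ψ i) (ψ j)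

  module Wᵢ = Walks adjᵢ

  reachᵢ⇒dist : ∀ {k i j} → Wᵢ.Reach k i j → dist X (ψ i) (ψ j) ≤ k
  reachᵢ⇒dist {k} r = dist-least (reach-map adjᵢ (adj X) ψ (λ e → e) k r)

  dist⇒reachᵢ : ∀ k {i j} → dist X (ψ i) (ψ j) ≤ k → Wᵢ.Reach k i j
  dist⇒reachᵢ zero    le rewrite ψ-injective (dist≤0 le) = Wᵢ.reach-zero⁺ _
  dist⇒reachᵢ (suc k) {i} {j} le with closed i j k le
  ... | inj₁ le′           = Wᵢ.reach-suc⁺ (dist⇒reachᵢ k le′)
  ... | inj₂ (l , le′ , e) = Wᵢ.reach-extend (dist⇒reachᵢ k le′) e

  induced : Graph
  induced = record
    { n         = m
    ; adj       = adjᵢ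
    ; adj-sym   = λ i j → adj-sym X (ψ i) (ψ j)
    ; irrefl    = λ i → irrefl X (ψ i)
    ; connected = λ i j → dist X (ψ i) (ψ j)
                        , Equivalence.to T-≡ (Wᵢ.Reach.holds (dist⇒reachᵢ _ ≤-refl))
    }

  induced-isometric : Isometric induced X ψ
  induced-isometric i j =
    sym (Distance.dist-unique induced (λ k → reachᵢ⇒dist) (dist⇒reachᵢ _ ≤-refl))

meet-sym : ∀ X {D E} → Meet X D E → Meet X E D
meet-sym X (u , inD , inE) = u , inE , inD

meet-self : ∀ X D → Meet X D D
meet-self X (c , r) = c , centre-in , centre-in
  where
    centre-in : dist X c c ≤ r
    centre-in = subst (_≤ r) (sym (Distance.dist-refl X c)) z≤n

meet-three : ∀ X {D₁ D₂ D₃} → Meet X D₁ D₂ → Meet X D₁ D₃ → Meet X D₂ D₃ →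
             ∀ {D E} → D ∈ₗ D₁ ∷ D₂ ∷ D₃ ∷ [] → E ∈ₗ D₁ ∷ D₂ ∷ D₃ ∷ [] →
             Meet X D E
meet-three X {D₁} {D₂} {D₃} m₁₂ m₁₃ m₂₃ = go
  where
    go : ∀ {D E} → D ∈ₗ D₁ ∷ D₂ ∷ D₃ ∷ [] → E ∈ₗ D₁ ∷ D₂ ∷ D₃ ∷ [] →
         Meet X D E
    go (here refl)                 (here refl)                 = meet-self X D₁
    go (here refl)                 (there (here refl))         = m₁₂
    go (here refl)                 (there (there (here refl))) = m₁₃
    go (there (here refl))         (here refl)                 = meet-sym X m₁₂
    go (there (here refl))         (there (here refl))         = meet-self X D₂
    go (there (here refl))         (there (there (here refl))) = m₂₃
    go (there (there (here refl))) (here refl)                 = meet-sym X m₁₃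
    go (there (there (here refl))) (there (here refl))         = meet-sym X m₂₃
    go (there (there (here refl))) (there (there (here refl))) = meet-self X D₃

lookup-injective : ∀ {A : Set} {xs : List A} → Unique xs →
                   ∀ {i j} → List.lookup xs i ≡ List.lookup xs j → i ≡ j
lookup-injective (x∉ ∷ xs!) {zero}  {zero}  eq = refl
lookup-injective (x∉ ∷ xs!) {zero}  {suc j} eq = ⊥-elim (All.lookup x∉ (∈-lookup j) eq)
lookup-injective (x∉ ∷ xs!) {suc i} {zero}  eq = ⊥-elim (All.lookup x∉ (∈-lookup i) (sym eq))
lookup-injective (x∉ ∷ xs!) {suc i} {suc j} eq = cong suc (lookup-injective xs! eq)

module BallSubgraph (X : Graph) (hX : Helly X) (c : Fin (n X)) (R : ℕ) where
  open Distance X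

  InBall : Fin (n X) → Set
  InBall x = dist X c x ≤ R

  members : List (Fin (n X))
  members = filter (λ x → dist X c x ≤? R) (allFin (n X))

  ψ : Fin (length members) → Fin (n X)
  ψ = List.lookup members

  ψ-inBall : ∀ i → InBall (ψ i)
  ψ-inBall i = proj₂ (∈-filter⁻ (λ x → dist X c x ≤? R) {xs = allFin (n X)} (∈-lookup i))

  ψ-injective : ∀ {i j} → ψ i ≡ ψ j → i ≡ j
  ψ-injective = lookup-injective (filter⁺ (λ x → dist X c x ≤? R) (allFin⁺ (n X)))

  position : ∀ {x} → InBall x → Fin (length members)
  position {x} x∈B = index (∈-filter⁺ (λ x → dist X c x ≤? R) (∈-allFin x) x∈B)

  ψ-position : ∀ {x} (x∈B : InBall x) → ψ (position x∈B) ≡ x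
  ψ-position {x} x∈B = sym (lookup-index (∈-filter⁺ (λ x → dist X c x ≤? R) (∈-allFin x) x∈B))

  meets-ball : ∀ i {r} → Meet X (c , R) (ψ i , r)
  meets-ball i {r} = ψ i , subst (_≤ R) (dist-sym c (ψ i)) (ψ-inBall i)
                         , subst (_≤ r) (sym (dist-refl (ψ i))) z≤n

  -- Helly applied to D(ψ i, k), D(ψ j, 1) and D(c, R) yields a step from ψ j
  -- towards ψ i that stays inside the ball.
  ball-step-closed : StepClosed X ψ
  ball-step-closed i j k le with dist-step le
  ... | inj₁ le′ = inj₁ le′
  ... | inj₂ (w , x~w , w~y) =
    step (helly-family X hX ((ψ i , k) ∷ (ψ j , 1) ∷ (c , R) ∷ [])
           (meet-three X (w , subst (_≤ k) (dist-sym (ψ i) w) x~w , dist-edge w~y)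
                         (meet-sym X (meets-ball i)) (meet-sym X (meets-ball j))))
    where
      step : (∃ λ z → ∀ {D} → D ∈ₗ (ψ i , k) ∷ (ψ j , 1) ∷ (c , R) ∷ [] →
                                 InDisk X z D) →
             dist X (ψ i) (ψ j) ≤ k ⊎ ∃ λ l → dist X (ψ i) (ψ l) ≤ k × T (adj X (ψ l) (ψ j))
      step (z , common) = classify z-near z∈B (dist≤1 (common (there (here refl))))
        where
          z-near : dist X (ψ i) z ≤ k
          z-near = subst (_≤ k) (dist-sym z (ψ i)) (common (here refl))

          z∈B : InBall z
          z∈B = subst (_≤ R) (dist-sym z c) (common (there (there (here refl))))

          classify : ∀ {z} → dist X (ψ i) z ≤ k → InBall z → z ≡ ψ j ⊎ T (adj X z (ψ j)) →
                     dist X (ψ i) (ψ j) ≤ k ⊎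
                     ∃ λ l → dist X (ψ i) (ψ l) ≤ k × T (adj X (ψ l) (ψ j))
          classify near _   (inj₁ refl) = inj₁ near
          classify near z∈B (inj₂ z~y) rewrite sym (ψ-position z∈B) =
            inj₂ (position z∈B , near , z~y)

  open Induced X ψ ψ-injective ball-step-closed public

  -- Pairwise meeting disks of the ball, together with the ball itself, form a
  -- pairwise meeting family of disks of X; a common vertex lies in the ball.
  ball-helly : Helly induced
  ball-helly S r pairwise = conclude (helly-family X hX family meets)
    where
      disk : Fin (length members) → Disk X
      disk i = ψ i , r i

      chosen : List (Fin (length members))
      chosen = filter (_∈? S) (allFin (length members))

      family : List (Disk X)
      family = (c , R) ∷ map disk chosen

      chosen-disk : ∀ {D} → D ∈ₗ map disk chosen → ∃ λ i → i ∈ S × D ≡ disk i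
      chosen-disk mem with ∈-map⁻ disk mem
      ... | i , mem′ , refl = i , proj₂ (∈-filter⁻ (_∈? S) {xs = allFin _} mem′) , refl

      meets : ∀ {D E} → D ∈ₗ family → E ∈ₗ family → Meet X D E
      meets (here refl) (here refl) = meet-self X (c , R)
      meets (here refl) (there mE) with chosen-disk mE
      ... | j , _ , refl = meets-ball j
      meets (there mD) (here refl) with chosen-disk mD
      ... | i , _ , refl = meet-sym X (meets-ball i)
      meets (there mD) (there mE) with chosen-disk mD | chosen-disk mE
      ... | i , i∈S , refl | j , j∈S , refl with pairwise i j i∈S j∈S
      ...   | u , ui , uj = ψ u , subst (_≤ r i) (sym (induced-isometric u i)) ui
                                , subst (_≤ r j) (sym (induced-isometric u j)) uj

      conclude : (∃ λ z → ∀ {D} → D ∈ₗ family → InDisk X z D) →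
                 ∃ λ p → ∀ i → i ∈ S → dist induced p i ≤ r i + 0
      conclude (z , common) = position z∈B , λ i i∈S → subst (_≤ r i + 0) (z-dist i)
          (subst (dist X z (ψ i) ≤_) (sym (+-identityʳ (r i)))
            (common (there (∈-map⁺ disk (∈-filter⁺ (_∈? S) (∈-allFin i) i∈S)))))
        where
          z∈B : InBall z
          z∈B = subst (_≤ R) (dist-sym z c) (common (here refl))

          z-dist : ∀ i → dist X z (ψ i) ≡ dist induced (position z∈B) i
          z-dist i = trans (cong (λ t → dist X t (ψ i)) (sym (ψ-position z∈B)))
                           (induced-isometric (position z∈B) i)

-- In the injective hull every disk containing G is all of H: the disk is an
-- isometric Helly subgraph of H containing G, so minimality applies.
hull-ball : ∀ G H φ → InjectiveHull G H φ →
            ∀ c R → (∀ u → dist H c (φ u) ≤ R) → ∀ w → dist H c w ≤ R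
hull-ball G H φ (hH , iso , minimal) c R G⊆B w =
  covered (minimal induced φ′ ψ ball-helly G-isometric induced-isometric
                   (λ u → ψ-position (G⊆B u)) w)
  where
    open BallSubgraph H hH c R

    φ′ : Fin (n G) → Fin (length members)
    φ′ u = position (G⊆B u)

    G-isometric : Isometric G induced φ′
    G-isometric u v = begin
      dist induced (φ′ u) (φ′ v)     ≡⟨ sym (induced-isometric (φ′ u) (φ′ v)) ⟩
      dist H (ψ (φ′ u)) (ψ (φ′ v))   ≡⟨ cong₂ (dist H) (ψ-position (G⊆B u)) (ψ-position (G⊆B v)) ⟩
      dist H (φ u) (φ v)             ≡⟨ iso u v ⟩
      dist G u v                     ∎
      where open ≡-Reasoning

    covered : (∃ λ x → ψ x ≡ w) → dist H c w ≤ R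
    covered (x , refl) = ψ-inBall x

hull-ecc : ∀ G H φ → InjectiveHull G H φ →
           ∀ c R → (∀ u → dist H c (φ u) ≤ R) → ecc H (λ v → v) ⊤ c ≤ R
hull-ecc G H φ hull c R G⊆B = ecc-lub H (λ v → v) ⊤ (λ {w} _ → hull-ball G H φ hull c R G⊆B w)

ecc-isometric : ∀ G H φ → Isometric G H φ → ∀ (M : Subset (n G)) v →
                ecc H φ M (φ v) ≡ ecc G (λ u → u) M v
ecc-isometric G H φ iso M v =
  cong maxL (map-cong {f = ecc-term H φ M (φ v)} {g = ecc-term G (λ u → u) M v} same (allFin (n G)))
  where
    same : ∀ u → ecc-term H φ M (φ v) u ≡ ecc-term G (λ u → u) M v u
    same u = cong (λ d → if lookup M u then d else 0) (iso v u)

ecc-restrict : ∀ X {k} (f : Fin k → Fin (n X)) (M : Subset k) v →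
               ecc X f M v ≤ ecc X (λ u → u) ⊤ v
ecc-restrict X f M v = ecc-lub X f M (λ _ → dist≤ecc X (λ u → u) ⊤ ∈⊤)

-- If G is α-weakly Helly and isometric in H, every vertex c of H has a
-- counterpart u in G: the disks D_G(x, e) (x ∈ M, e = e^M_H(c)) meet pairwise,
-- since d_G(x, y) = d_H(x, y) ≤ 2e, so some u lies within e + α of all of M.
weakly-helly-centre : ∀ α G H φ → WeaklyHelly α G → Isometric G H φ →
                      ∀ (M : Subset (n G)) c → ∃ λ u → ecc G (λ v → v) M u ≤ ecc H φ M c + α
weakly-helly-centre α G H φ wh iso M c = centre (wh M (λ _ → e) pairwise)
  where
    e : ℕ
    e = ecc H φ M c

    G-close : ∀ {x y} → x ∈ M → y ∈ M → dist G x y ≤ e + e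
    G-close {x} {y} x∈M y∈M = subst (_≤ e + e) (iso x y)
      (≤-trans (Distance.dist-triangle H (φ x) c (φ y))
               (+-mono-≤ (subst (_≤ e) (Distance.dist-sym H c (φ x)) (dist≤ecc H φ M x∈M))
                         (dist≤ecc H φ M y∈M)))

    midpoint : ∀ {x y} → (∃ λ u → dist G x u ≤ e × dist G u y ≤ e) →
               ∃ λ u → dist G u x ≤ e × dist G u y ≤ e
    midpoint {x} (u , xu , uy) = u , subst (_≤ e) (Distance.dist-sym G x u) xu , uy

    pairwise : ∀ x y → x ∈ M → y ∈ M → ∃ λ u → dist G u x ≤ e × dist G u y ≤ e
    pairwise x y x∈M y∈M = midpoint (Distance.dist-split G e e (G-close x∈M y∈M))

    centre : (∃ λ u → ∀ x → x ∈ M → dist G u x ≤ e + α) →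
             ∃ λ u → ecc G (λ v → v) M u ≤ e + α
    centre (u , near) = u , ecc-lub G (λ v → v) M (λ {x} x∈M → near x x∈M)

rad-lower : ∀ α G H φ → WeaklyHelly α G → Isometric G H φ →
            ∀ M → rad G (λ v → v) M ≤ rad H φ M + α
rad-lower α G H φ wh iso M = minL-compare (ecc G (λ v → v) M) (ecc H φ M) α
  (weakly-helly-centre α G H φ wh iso M) (λ noH v → ⊥-elim (noH (φ v)))

drop+0 : ∀ {a b} → a ≤ b + 0 → a ≤ b
drop+0 {a} {b} = subst (a ≤_) (+-identityʳ b)

-- Upper bound: every vertex of G has the same eccentricity in H.
rad-upper : ∀ G H φ → Isometric G H φ → ∀ M → rad H φ M ≤ rad G (λ v → v) M
rad-upper G H φ iso M = drop+0 (minL-compare (ecc H φ M) (ecc G (λ v → v) M) 0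
  (λ v → φ v , ≤-reflexive (trans (ecc-isometric G H φ iso M v) (sym (+-identityʳ _))))
  (λ noG w → ecc-lub H φ M (λ {u} _ → ⊥-elim (noG u))))

rad-image≤radius : ∀ G H (φ : Fin (n G) → Fin (n H)) → rad H φ ⊤ ≤ radius H
rad-image≤radius G H φ = drop+0 (minL-compare (ecc H φ ⊤) (ecc H (λ v → v) ⊤) 0
  (λ w → w , ≤-trans (ecc-restrict H φ ⊤ w) (m≤m+n _ 0))
  (λ noH w → ⊥-elim (noH w)))

-- radius H ≤ radius G: a centre v of G keeps its eccentricity in H, by hull-ecc
radius-upper : ∀ G H φ → InjectiveHull G H φ → radius H ≤ radius G
radius-upper G H φ hull@(_ , iso , _) =
  drop+0 (minL-compare (ecc H (λ v → v) ⊤) (ecc G (λ v → v) ⊤) 0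
    (λ v → φ v , ≤-trans (hull-ecc G H φ hull (φ v) (ecc G (λ v → v) ⊤ v) (G-in-disk v))
                         (m≤m+n _ 0))
    (λ noG w → hull-ecc G H φ hull w 0 (λ u → ⊥-elim (noG u))))
  where
    G-in-disk : ∀ v u → dist H (φ v) (φ u) ≤ ecc G (λ v → v) ⊤ v
    G-in-disk v u =
      subst (_≤ ecc G (λ v → v) ⊤ v) (sym (iso v u)) (dist≤ecc G (λ v → v) ⊤ ∈⊤)

proposition5 : (α : ℕ) (G : Graph) → WeaklyHelly α G →
    (H : Graph) (φ : Fin (n G) → Fin (n H)) → InjectiveHull G H φ →
    ((M : Subset (n G)) →
      (rad G (λ v → v) M ∸ α ≤ rad H φ M) × (rad H φ M ≤ rad G (λ v → v) M))
    × ((radius G ∸ α ≤ radius H) × (radius H ≤ radius G))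
proposition5 α G wh H φ hull@(_ , iso , _) =
  (λ M → shift (rad-lower α G H φ wh iso M) , rad-upper G H φ iso M) ,
  shift (≤-trans (rad-lower α G H φ wh iso ⊤) (+-monoˡ-≤ α (rad-image≤radius G H φ))) ,
  radius-upper G H φ hull
  where
    shift : ∀ {a b} → a ≤ b + α → a ∸ α ≤ b
    shift {a} {b} le = m≤n+o⇒m∸n≤o a α (subst (a ≤_) (+-comm b α) le)
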